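{- Let $k \ge 0$ be an integer and let $G=(X\cup Y,E)$ be a bipartite graph with bipartition $(X,Y)$ (so $X\cap Y=\emptyset$ and $E\subseteq\{\{x,y\}: x\in X, y\in Y\}$). If $G$ contains a vertex that has more than $2k+2$ neighbors which are not leaves, then $G$ admits no 2-layer $k$-planar drawing.
   Context: A leaf is a vertex with exactly one neighbor. A 2-layer drawing of $G$ is a pair $D=(<_X,<_Y)$ of strict linear orders on $X$ and on $Y$. Two edges $\{x,y\},\{x',y'\}$ with $x,x'\in X$ distinct and $y,y'\in Y$ distinct cross in $D$ if $x<_X x'$ and $y'<_Y y$ (or symmetrically $x'<_X x$ and $y<_Y y'$). For an edge $e$, $\mathrm{cross}_D(e)$ is the number of edges crossing $e$ in $D$. The drawing $D$ is $k$-planar if $\mathrm{cross}_D(e)\le k$ for every edge $e$. -}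

module Defs where

open import Level using (0ℓ)
open import Data.Nat using (ℕ; _≤_; _<_; _+_; _*_)
open import Data.Bool using (Bool; true; false; _∧_; _∨_; if_then_else_)
open import Data.Fin using (Fin)
open import Data.List using (List; length; filterᵇ; allFin; cartesianProduct)
open import Data.Product using (_×_; _,_; Σ; ∃; ∃-syntax)
open import Data.Sum using (_⊎_)
open import Relation.Binary using (Rel; IsStrictTotalOrder)
open import Relation.Binary.PropositionalEquality using (_≡_)
open import Relation.Nullary using (¬_)
open import Relation.Nullary.Decidable using (⌊_⌋)

-- A finite bipartite graph with bipartition (X , Y), X = Fin m, Y = Fin n
-- (disjoint by construction); edges are given by a (decidable) adjacency
-- relation between X and Y, so every edge is of the form {x , y}.
record BipGraph (m n : ℕ) : Set where
  field
    adj : Fin m → Fin n → Bool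

open BipGraph public

degX : ∀ {m n} → BipGraph m n → Fin m → ℕ
degX G x = length (filterᵇ (λ y → adj G x y) (allFin _))

degY : ∀ {m n} → BipGraph m n → Fin n → ℕ
degY G y = length (filterᵇ (λ x → adj G x y) (allFin _))

IsLeafX : ∀ {m n} → BipGraph m n → Fin m → Set
IsLeafX G x = degX G x ≡ 1

IsLeafY : ∀ {m n} → BipGraph m n → Fin n → Set
IsLeafY G y = degY G y ≡ 1

isLeafXᵇ : ∀ {m n} → BipGraph m n → Fin m → Bool
isLeafXᵇ G x = ⌊ degX G x Data.Nat.≟ 1 ⌋

isLeafYᵇ : ∀ {m n} → BipGraph m n → Fin n → Bool
isLeafYᵇ G y = ⌊ degY G y Data.Nat.≟ 1 ⌋

nonLeafNbrsX : ∀ {m n} → BipGraph m n → Fin m → ℕ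
nonLeafNbrsX G x =
  length (filterᵇ (λ y → adj G x y ∧ Data.Bool.not (isLeafYᵇ G y)) (allFin _))

nonLeafNbrsY : ∀ {m n} → BipGraph m n → Fin n → ℕ
nonLeafNbrsY G y =
  length (filterᵇ (λ x → adj G x y ∧ Data.Bool.not (isLeafXᵇ G x)) (allFin _))

record StrictLinearOrder (A : Set) : Set₁ where
  field
    _≺_ : Rel A 0ℓ
    isSTO : IsStrictTotalOrder _≡_ _≺_

  _≺?_ : (a b : A) → Bool
  a ≺? b = ⌊ IsStrictTotalOrder._<?_ isSTO a b ⌋

-- a 2-layer drawing: a pair of strict linear orders on X and on Y
record Drawing (m n : ℕ) : Set₁ where
  field
    ordX : StrictLinearOrder (Fin m)
    ordY : StrictLinearOrder (Fin n)

  _<X?_ : Fin m → Fin m → Bool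
  _<X?_ = StrictLinearOrder._≺?_ ordX

  _<Y?_ : Fin n → Fin n → Bool
  _<Y?_ = StrictLinearOrder._≺?_ ordY

-- edges {x,y} and {x',y'} cross: x <X x' and y' <Y y, or x' <X x and y <Y y'
-- (strictness forces x ≠ x' and y ≠ y')
crossesᵇ : ∀ {m n} → Drawing m n → Fin m → Fin n → Fin m → Fin n → Bool
crossesᵇ D x y x' y' =
  ((x <X? x') ∧ (y' <Y? y)) ∨ ((x' <X? x) ∧ (y <Y? y'))
  where open Drawing D

cross : ∀ {m n} → BipGraph m n → Drawing m n → Fin m → Fin n → ℕ
cross G D x y =
  length (filterᵇ (λ p → adj G (Data.Product.proj₁ p) (Data.Product.proj₂ p)
                          ∧ crossesᵇ D x y (Data.Product.proj₁ p) (Data.Product.proj₂ p))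
                  (cartesianProduct (allFin _) (allFin _)))

IsKPlanar : ∀ {m n} → ℕ → BipGraph m n → Drawing m n → Set
IsKPlanar k G D = ∀ x y → adj G x y ≡ true → cross G D x y ≤ k

-- Let x have more than 2k + 2 non-leaf neighbours. Each of them has a second neighbour
-- b ≠ x, to the right or to the left of x, so at least k + 2 of them, say, have a
-- neighbour to the right of x (the left case is the right case after reversing both
-- layers, and a vertex of Y is a vertex of X after transposing the graph and drawing).
-- Let y be the leftmost of these and b a neighbour of y right of x: every edge from x to
-- one of the other k + 1 lies right of y, so crosses {b , y}.
module Submission where

open import Level using (0ℓ)
open import Data.Bool using (Bool; true; false; T; T?; _∧_; _∨_; not)
open import Data.Bool.ListAction using (any)
open import Data.Bool.Properties using (T-∧; T-∨; T-≡)
open import Data.Fin using (Fin)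
open import Data.Fin.Properties using (_≟_)
open import Data.List using (List; []; _∷_; _++_; length; map; filterᵇ; allFin; cartesianProduct)
import Data.List.Extrema as Extrema
open import Data.List.Membership.Propositional using (_∈_; lose)
open import Data.List.Membership.Propositional.Properties using (∈-filter⁺; ∈-allFin)
open import Data.List.Properties using (filter-some; filter-none; filter-++; length-++)
open import Data.List.Relation.Binary.Sublist.Heterogeneous.Properties
  using (length-mono-≤; ⊆-filter-Sublist)
open import Data.List.Relation.Binary.Sublist.Propositional using (⊆-refl)
import Data.List.Relation.Unary.All as All
open import Data.List.Relation.Unary.All.Properties using (all-filter)
open import Data.List.Relation.Unary.Any using (here; there; satisfied)
open import Data.List.Relation.Unary.Any.Properties using (any⁺; any⁻)
open import Data.List.Relation.Unary.Unique.Propositional using (Unique; []; _∷_)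
open import Data.List.Relation.Unary.Unique.Propositional.Properties using (allFin⁺)
open import Data.Nat using (ℕ; suc; _≤_; _<_; _+_; _*_; z≤n; s≤s; _<?_)
open import Data.Nat.Properties
  using (≤-refl; ≤-trans; ≤-reflexive; ≤-pred; n≤1+n; +-suc; +-monoʳ-≤; +-mono-≤; m≤m+n; m≤n+m;
         ≤∧≢⇒<; <⇒≱; ≮⇒≥; module ≤-Reasoning)
open import Data.Nat.Tactic.RingSolver using (solve-∀)
import Data.Product as Product
open import Data.Product using (Σ; _×_; _,_; ∃-syntax; proj₁; proj₂)
open import Data.Product.Function.NonDependent.Propositional using (_×-⇔_)
import Data.Sum as Sum
open import Data.Sum using (_⊎_; inj₁; inj₂)
open import Data.Sum.Function.Propositional using (_⊎-⇔_)
open import Function using (_∘_; flip; _⇔_; mk⇔; Equivalence)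
import Function.Properties.Equivalence as ⇔
open import Relation.Binary
  using (IsStrictTotalOrder; TotalOrder; DecidableEquality; tri<; tri≈; tri>)
import Relation.Binary.Construct.Flip.EqAndOrd as Flip
import Relation.Binary.Construct.StrictToNonStrict as StrictToNonStrict
open import Relation.Binary.PropositionalEquality using (_≡_; _≢_; refl; sym; cong; module ≡-Reasoning)
open import Relation.Nullary using (¬_; yes; no; contradiction)
open import Relation.Nullary.Decidable using (⌊_⌋; toWitness; fromWitness; toWitnessFalse)

open import Defs
open Drawing using (ordX; ordY)

T-∧-mapʳ : ∀ {a b c} → (T b → T c) → T (a ∧ b) → T (a ∧ c)
T-∧-mapʳ {true}  f = f
T-∧-mapʳ {false} f ()

2k+2<r+l⇒k+1<r⊎k+1<l : ∀ k r l → 2 * k + 2 < r + l → suc k < r ⊎ suc k < l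
2k+2<r+l⇒k+1<r⊎k+1<l k r l r+l-large with suc k <? r | suc k <? l
... | yes r-large | _           = inj₁ r-large
... | no _        | yes l-large = inj₂ l-large
... | no r-small  | no l-small  =
  contradiction (≤-trans (+-mono-≤ (≮⇒≥ r-small) (≮⇒≥ l-small)) (≤-reflexive (double k)))
                (<⇒≱ r+l-large)
  where
  double : ∀ k → suc k + suc k ≡ 2 * k + 2
  double = solve-∀

count : {A : Set} → (A → Bool) → List A → ℕ
count p xs = length (filterᵇ p xs)

module _ {A : Set} {p : A → Bool} where

  count-mono : {q : A → Bool} → (∀ {x} → T (p x) → T (q x)) → ∀ xs → count p xs ≤ count q xs
  count-mono p⇒q xs =
    length-mono-≤ (⊆-filter-Sublist _ _ (λ { refl → p⇒q }) (⊆-refl {x = xs}))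

  count-∨ : (q : A → Bool) → ∀ xs → count (λ x → p x ∨ q x) xs ≤ count p xs + count q xs
  count-∨ q [] = z≤n
  count-∨ q (x ∷ xs) with p x | q x
  ... | true  | true  = s≤s (≤-trans (count-∨ q xs) (+-monoʳ-≤ (count p xs) (n≤1+n _)))
  ... | true  | false = s≤s (count-∨ q xs)
  ... | false | true  = ≤-trans (s≤s (count-∨ q xs)) (≤-reflexive (sym (+-suc _ _)))
  ... | false | false = count-∨ q xs

  count-pos : ∀ {x xs} → x ∈ xs → T (p x) → 0 < count p xs
  count-pos x∈xs px = filter-some (T? ∘ p) (lose x∈xs px)

  count-witness : ∀ xs → 0 < count p xs → ∃[ x ] T (p x)
  count-witness (x ∷ xs) pos with p x in eq
  ... | true  = x , Equivalence.from T-≡ eq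
  ... | false = count-witness xs pos

  count-map : {B : Set} (f : B → A) → ∀ ys → count p (map f ys) ≡ count (p ∘ f) ys
  count-map f [] = refl
  count-map f (y ∷ ys) with p (f y)
  ... | true  = cong suc (count-map f ys)
  ... | false = count-map f ys

module _ {A : Set} (_≟ᴬ_ : DecidableEquality A) where

  count-≟≤1 : ∀ a {xs} → Unique xs → count (λ z → ⌊ z ≟ᴬ a ⌋) xs ≤ 1
  count-≟≤1 a [] = z≤n
  count-≟≤1 a {x ∷ xs} (x∉xs ∷ unique) with x ≟ᴬ a
  ... | yes refl =
    s≤s (≤-reflexive (cong length (filter-none _ (All.map (λ x≢z → x≢z ∘ sym ∘ toWitness) x∉xs))))
  ... | no _     = count-≟≤1 a unique

  count≤suc-count-others : ∀ (p : A → Bool) a {xs} → Unique xs →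
                           count p xs ≤ suc (count (λ z → p z ∧ not ⌊ z ≟ᴬ a ⌋) xs)
  count≤suc-count-others p a {xs} unique = begin
    count p xs                                     ≤⟨ count-mono split xs ⟩
    count (λ z → ⌊ z ≟ᴬ a ⌋ ∨ others z) xs         ≤⟨ count-∨ others xs ⟩
    count (λ z → ⌊ z ≟ᴬ a ⌋) xs + count others xs  ≤⟨ +-mono-≤ (count-≟≤1 a unique) ≤-refl ⟩
    suc (count others xs)                          ∎
    where
    open ≤-Reasoning
    others : A → Bool
    others z = p z ∧ not ⌊ z ≟ᴬ a ⌋
    split : ∀ {z} → T (p z) → T (⌊ z ≟ᴬ a ⌋ ∨ others z)
    split {z} pz with z ≟ᴬ a
    ... | yes _ = _
    ... | no  _ = Equivalence.from T-∧ (pz , _)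

  count≢1⇒other : ∀ (p : A → Bool) {a xs} → Unique xs → a ∈ xs → T (p a) →
                  count p xs ≢ 1 → ∃[ z ] z ≢ a × T (p z)
  count≢1⇒other p {a} {xs} unique a∈xs pa count≢1 =
    let 1<count = ≤∧≢⇒< (count-pos a∈xs pa) (count≢1 ∘ sym)
        z , w    = count-witness xs (≤-pred (≤-trans 1<count (count≤suc-count-others p a unique)))
        pz , z≢a = Equivalence.to T-∧ w
    in z , toWitnessFalse z≢a , pz

module _ {A B : Set} (p : A × B → Bool) where

  count-cartesianProduct-∷ : ∀ x xs ys → count p (cartesianProduct (x ∷ xs) ys)
                             ≡ count (λ y → p (x , y)) ys + count p (cartesianProduct xs ys)
  count-cartesianProduct-∷ x xs ys = begin
    length (filterᵇ p (map (x ,_) ys ++ cartesianProduct xs ys))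
      ≡⟨ cong length (filter-++ _ (map (x ,_) ys) _) ⟩
    length (filterᵇ p (map (x ,_) ys) ++ filterᵇ p (cartesianProduct xs ys))
      ≡⟨ length-++ (filterᵇ p (map (x ,_) ys)) ⟩
    count p (map (x ,_) ys) + count p (cartesianProduct xs ys)
      ≡⟨ cong (_+ count p (cartesianProduct xs ys)) (count-map (x ,_) ys) ⟩
    count (λ y → p (x , y)) ys + count p (cartesianProduct xs ys) ∎
    where open ≡-Reasoning

  count-row≤count-cartesianProduct :
    ∀ {x xs} ys → x ∈ xs → count (λ y → p (x , y)) ys ≤ count p (cartesianProduct xs ys)
  count-row≤count-cartesianProduct {x} {x ∷ xs} ys (here refl) =
    ≤-trans (m≤m+n _ _) (≤-reflexive (sym (count-cartesianProduct-∷ x xs ys)))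
  count-row≤count-cartesianProduct {x} {x' ∷ xs} ys (there x∈xs) =
    ≤-trans (≤-trans (count-row≤count-cartesianProduct ys x∈xs) (m≤n+m _ _))
            (≤-reflexive (sym (count-cartesianProduct-∷ x' xs ys)))

  count-column≤count-cartesianProduct :
    ∀ {y ys} xs → y ∈ ys → count (λ x → p (x , y)) xs ≤ count p (cartesianProduct xs ys)
  count-column≤count-cartesianProduct [] y∈ys = z≤n
  count-column≤count-cartesianProduct {y} {ys} (x ∷ xs) y∈ys with p (x , y) in eq
  ... | true  = ≤-trans (+-mono-≤ (count-pos y∈ys (Equivalence.from T-≡ eq))
                                  (count-column≤count-cartesianProduct xs y∈ys))
                        (≤-reflexive (sym (count-cartesianProduct-∷ x xs ys)))
  ... | false = ≤-trans (≤-trans (count-column≤count-cartesianProduct xs y∈ys) (m≤n+m _ _))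
                        (≤-reflexive (sym (count-cartesianProduct-∷ x xs ys)))

infix 4 _≺[_]_
_≺[_]_ : {A : Set} → A → StrictLinearOrder A → A → Set
a ≺[ O ] b = StrictLinearOrder._≺_ O a b

module _ {A : Set} (O : StrictLinearOrder A) where
  open StrictLinearOrder O

  T-≺? : ∀ {a b} → T (a ≺? b) ⇔ a ≺ b
  T-≺? = mk⇔ toWitness fromWitness

  reverseOrder : StrictLinearOrder A
  reverseOrder = record { _≺_ = flip _≺_ ; isSTO = Flip.isStrictTotalOrder isSTO }

  least : (p : A → Bool) (xs : List A) {z : A} → z ∈ xs → T (p z) →
          ∃[ y ] T (p y) × (∀ {z} → z ∈ xs → T (p z) → z ≢ y → y ≺ z)
  least p xs {z} z∈xs pz = y , py , above
    where
    totalOrder : TotalOrder 0ℓ 0ℓ 0ℓ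
    totalOrder = record { isTotalOrder = StrictToNonStrict.isTotalOrder _≡_ _≺_ isSTO }
    open Extrema totalOrder using (min; min≤xs; argmin-all)
    y : A
    y = min z (filterᵇ p xs)
    py : T (p y)
    py = argmin-all (λ a → a) pz (all-filter (T? ∘ p) xs)
    above : ∀ {z'} → z' ∈ xs → T (p z') → z' ≢ y → y ≺ z'
    above z'∈xs pz' z'≢y
      with All.lookup (min≤xs z (filterᵇ p xs)) (∈-filter⁺ (T? ∘ p) z'∈xs pz')
    ... | inj₁ y≺z' = y≺z'
    ... | inj₂ y≡z' = contradiction (sym y≡z') z'≢y

Crosses : ∀ {m n} → Drawing m n → Fin m → Fin n → Fin m → Fin n → Set
Crosses D x y x' y' =
  (x ≺[ ordX D ] x' × y' ≺[ ordY D ] y) ⊎ (x' ≺[ ordX D ] x × y ≺[ ordY D ] y')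

T-crossesᵇ : ∀ {m n} (D : Drawing m n) {x y x' y'} →
             T (crossesᵇ D x y x' y') ⇔ Crosses D x y x' y'
T-crossesᵇ D = ⇔.trans T-∨ (⇔.trans T-∧ (T-≺? (ordX D) ×-⇔ T-≺? (ordY D))
                      ⊎-⇔ ⇔.trans T-∧ (T-≺? (ordX D) ×-⇔ T-≺? (ordY D)))

T-crossesᵇ-map : ∀ {m n m' n'} (D : Drawing m n) (D' : Drawing m' n') {x y x' y' u v u' v'} →
                 (Crosses D x y x' y' → Crosses D' u v u' v') →
                 T (crossesᵇ D x y x' y') → T (crossesᵇ D' u v u' v')
T-crossesᵇ-map D D' f = Equivalence.from (T-crossesᵇ D') ∘ f ∘ Equivalence.to (T-crossesᵇ D)

reverseDrawing : ∀ {m n} → Drawing m n → Drawing m n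
reverseDrawing D = record { ordX = reverseOrder (ordX D) ; ordY = reverseOrder (ordY D) }

crosses-reverse : ∀ {m n} (D : Drawing m n) {x y x' y'} →
                  Crosses (reverseDrawing D) x y x' y' → Crosses D x y x' y'
crosses-reverse D = Sum.swap

transposeGraph : ∀ {m n} → BipGraph m n → BipGraph n m
transposeGraph G = record { adj = flip (adj G) }

transposeDrawing : ∀ {m n} → Drawing m n → Drawing n m
transposeDrawing D = record { ordX = ordY D ; ordY = ordX D }

crosses-transpose : ∀ {m n} (D : Drawing m n) {x y x' y'} →
                    Crosses (transposeDrawing D) y x y' x' → Crosses D x y x' y'
crosses-transpose D = Sum.swap ∘ Sum.map Product.swap Product.swap

crossingsAt : ∀ {m n} → BipGraph m n → Drawing m n → Fin m → Fin m → Fin n → ℕ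
crossingsAt {n = n} G D x b y = count (λ y' → adj G x y' ∧ crossesᵇ D b y x y') (allFin n)

crossingsAt≤cross : ∀ {m n} (G : BipGraph m n) D x b y → crossingsAt G D x b y ≤ cross G D b y
crossingsAt≤cross {n = n} G D x b y =
  count-row≤count-cartesianProduct _ (allFin n) (∈-allFin x)

crossingsAt-reverse : ∀ {m n} (G : BipGraph m n) D x b y →
                      crossingsAt G (reverseDrawing D) x b y ≤ crossingsAt G D x b y
crossingsAt-reverse {n = n} G D x b y =
  count-mono (T-∧-mapʳ (T-crossesᵇ-map (reverseDrawing D) D (crosses-reverse D))) (allFin n)

crossingsAt-transpose≤cross : ∀ {m n} (G : BipGraph m n) D y b x →
                              crossingsAt (transposeGraph G) (transposeDrawing D) y b x ≤ cross G D x b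
crossingsAt-transpose≤cross {m} {n} G D y b x = begin
  crossingsAt (transposeGraph G) (transposeDrawing D) y b x
    ≤⟨ count-mono (T-∧-mapʳ (T-crossesᵇ-map (transposeDrawing D) D (crosses-transpose D)))
                  (allFin m) ⟩
  count (λ x' → adj G x' y ∧ crossesᵇ D x b x' y) (allFin m)
    ≤⟨ count-column≤count-cartesianProduct _ (allFin m) (∈-allFin y) ⟩
  cross G D x b ∎
  where open ≤-Reasoning

rightLinkedᵇ : ∀ {m n} → BipGraph m n → Drawing m n → Fin m → Fin n → Bool
rightLinkedᵇ {m} G D x y = adj G x y ∧ any (λ b → adj G b y ∧ (x <X? b)) (allFin m)
  where open Drawing D

rightLinkedNbrs : ∀ {m n} → BipGraph m n → Drawing m n → Fin m → ℕ
rightLinkedNbrs {n = n} G D x = count (rightLinkedᵇ G D x) (allFin n)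

rightLinkedNbrs≤suc-crossingsAt :
  ∀ {m n} (G : BipGraph m n) D {x b y} → x ≺[ ordX D ] b →
  (∀ {y'} → T (rightLinkedᵇ G D x y') → y' ≢ y → y ≺[ ordY D ] y') →
  rightLinkedNbrs G D x ≤ suc (crossingsAt G D x b y)
rightLinkedNbrs≤suc-crossingsAt {n = n} G D {x} {b} {y} x<b above =
  ≤-trans (count≤suc-count-others _≟_ (rightLinkedᵇ G D x) y (allFin⁺ n))
          (s≤s (count-mono crossed (allFin n)))
  where
  crossed : ∀ {y'} → T (rightLinkedᵇ G D x y' ∧ not ⌊ y' ≟ y ⌋) →
            T (adj G x y' ∧ crossesᵇ D b y x y')
  crossed w with Equivalence.to T-∧ w
  ... | linked , y'≢y = Equivalence.from T-∧
    ( proj₁ (Equivalence.to T-∧ linked)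
    , Equivalence.from (T-crossesᵇ D) (inj₂ (x<b , above linked (toWitnessFalse y'≢y))))

rightLinked⇒crossings : ∀ {m n k} (G : BipGraph m n) D {x} → suc k < rightLinkedNbrs G D x →
                        ∃[ b ] ∃[ y ] T (adj G b y) × k < crossingsAt G D x b y
rightLinked⇒crossings {m} {n} G D {x} many =
  let z , linked-z       = count-witness (allFin n) (≤-trans (s≤s z≤n) many)
      y , linked-y , above = least (ordY D) (rightLinkedᵇ G D x) (allFin n) (∈-allFin z) linked-z
      b , b-witness      = satisfied (any⁻ _ (allFin m) (proj₂ (Equivalence.to T-∧ linked-y)))
      edge , x<b         = Equivalence.to T-∧ b-witness
  in b , y , edge , ≤-pred (≤-trans many
       (rightLinkedNbrs≤suc-crossingsAt G D (toWitness x<b) (above (∈-allFin _))))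

nonLeafNbrsX≤rightLinked+leftLinked : ∀ {m n} (G : BipGraph m n) D x →
  nonLeafNbrsX G x ≤ rightLinkedNbrs G D x + rightLinkedNbrs G (reverseDrawing D) x
nonLeafNbrsX≤rightLinked+leftLinked {m} {n} G D x =
  ≤-trans (count-mono linked (allFin n)) (count-∨ (rightLinkedᵇ G (reverseDrawing D) x) (allFin n))
  where
  open IsStrictTotalOrder (StrictLinearOrder.isSTO (ordX D)) using (compare)
  linkedVia : ∀ D' {y b} → T (adj G x y) → T (adj G b y) → x ≺[ ordX D' ] b →
              T (rightLinkedᵇ G D' x y)
  linkedVia D' {b = b} xy by x<b =
    Equivalence.from T-∧
      (xy , any⁺ _ (lose (∈-allFin b) (Equivalence.from T-∧ (by , fromWitness x<b))))
  linked : ∀ {y} → T (adj G x y ∧ not (isLeafYᵇ G y)) →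
           T (rightLinkedᵇ G D x y ∨ rightLinkedᵇ G (reverseDrawing D) x y)
  linked {y} w with Equivalence.to T-∧ w
  ... | xy , nonLeaf
    with count≢1⇒other _≟_ (λ b → adj G b y) (allFin⁺ m) (∈-allFin x) xy (toWitnessFalse nonLeaf)
  ... | b , b≢x , by with compare x b
  ... | tri< x<b _ _ = Equivalence.from T-∨ (inj₁ (linkedVia D xy by x<b))
  ... | tri≈ _ x≡b _ = contradiction (sym x≡b) b≢x
  ... | tri> _ _ b<x = Equivalence.from T-∨ (inj₂ (linkedVia (reverseDrawing D) xy by b<x))

crowded⇒crossings : ∀ {m n k} (G : BipGraph m n) D {x} → 2 * k + 2 < nonLeafNbrsX G x →
                    ∃[ b ] ∃[ y ] T (adj G b y) × k < crossingsAt G D x b y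
crowded⇒crossings {k = k} G D {x} crowded
  with 2k+2<r+l⇒k+1<r⊎k+1<l k _ _ (≤-trans crowded (nonLeafNbrsX≤rightLinked+leftLinked G D x))
... | inj₁ right = rightLinked⇒crossings G D right
... | inj₂ left  =
  let b , y , edge , many = rightLinked⇒crossings G (reverseDrawing D) left
  in b , y , edge , ≤-trans many (crossingsAt-reverse G D x b y)

mainTheorem1 : (k m n : ℕ) (G : BipGraph m n)
    → ((∃[ x ] 2 * k + 2 < nonLeafNbrsX G x) ⊎ (∃[ y ] 2 * k + 2 < nonLeafNbrsY G y))
    → ¬ (Σ (Drawing m n) (λ D → IsKPlanar k G D))
mainTheorem1 k m n G (inj₁ (x , crowded)) (D , planar) =
  let b , y , edge , many = crowded⇒crossings G D crowded
  in <⇒≱ many (≤-trans (crossingsAt≤cross G D x b y) (planar b y (Equivalence.to T-≡ edge)))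
mainTheorem1 k m n G (inj₂ (y , crowded)) (D , planar) =
  let b , x , edge , many = crowded⇒crossings (transposeGraph G) (transposeDrawing D) crowded
  in <⇒≱ many (≤-trans (crossingsAt-transpose≤cross G D y b x)
                       (planar x b (Equivalence.to T-≡ edge)))
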